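{- Let $n,d,p$ be non-negative integers with $d<n$ and $p\le n-d$, and let $\tau\in\bar{\mathcal{S}}_p(n,d)$. Then every $+$-component of $\tau$ contains exactly one source subset $S_{n,d,i}$, $i\in[0,d]$.
   Context: $[a,b]=\{x\in\mathbb{Z}:a\le x\le b\}$, $[n]=[1,n]$. A $d$-subset of $[n]$ is written as its increasing tuple $B=(b_1,\dots,b_d)$. For a function $f$ on $d$-subsets of $[n]$, a $d$-subset $B$ and $j\in[d]$, let $B_j=B\setminus\{b_j\}$ and $[n]\setminus B_j=\{x_1<\dots<x_{n-d+1}\}$; the $(f,B,j)$-series is $(f(B_j\cup\{x_1\}),\dots,f(B_j\cup\{x_{n-d+1}\}))$, and for $f$ the identity it is called the $(B,j)$-series. For $0\le d<n$, a $d$-co-signotope on $n$ elements is a map $\tau:\binom{[n]}{d}\to\{+,-\}$ such that every $(\tau,B,j)$-series has at most one sign change. A $+$-subset of $\tau$ is a $d$-subset $R$ with $\tau(R)=+$. $\bar{\mathcal{S}}_p(n,d)$ is the set of $d$-co-signotopes on $n$ elements with exactly $p$ $+$-subsets. The graph $G_{n,d}$ has the $d$-subsets of $[n]$ as vertices, two being adjacent if they are consecutive entries of some $(B,j)$-series. A $+$-component of $\tau$ is a connected component of the subgraph of $G_{n,d}$ induced by the $+$-subsets of $\tau$. For $i\in[0,d]$, the source subset is $S_{n,d,i}=\{1,\dots,i\}\cup\{n-d+i+1,\dots,n\}$. -}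

module Defs where

open import Data.Nat using (ℕ; zero; suc; _+_; _∸_; _≤_; _<_; _≤ᵇ_; _≟_)
open import Data.Bool using (Bool; true; false; if_then_else_)
open import Data.Fin using (Fin)
open import Data.List using (List; []; _∷_; map; filter; upTo; length; removeAt; _++_)
open import Data.List.Relation.Unary.All using (All)
open import Data.List.Relation.Unary.Linked using (Linked)
open import Data.List.Relation.Unary.AllPairs using (AllPairs)
open import Data.List.Membership.Propositional using (_∈_)
open import Data.List.Membership.DecPropositional _≟_ using (_∈?_)
open import Data.Product using (Σ; ∃; _×_; _,_)
open import Data.Sum using (_⊎_)
open import Relation.Nullary using (¬?)
open import Relation.Binary.PropositionalEquality using (_≡_; _≢_)
open import Relation.Binary.Construct.Closure.ReflexiveTransitive using (Star)
open import Function.Bundles using (_⇔_)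

data Sign : Set where
  plus minus : Sign

IsDSubset : ℕ → ℕ → List ℕ → Set
IsDSubset n d B = Linked _<_ B × All (λ x → 1 ≤ x × x ≤ n) B × length B ≡ d

oneTo : ℕ → List ℕ
oneTo n = map suc (upTo n)

ins : ℕ → List ℕ → List ℕ
ins x [] = x ∷ []
ins x (y ∷ ys) = if x ≤ᵇ y then x ∷ y ∷ ys else y ∷ ins x ys

-- The (B,j)-series (j is a 0-based position in B, i.e. j+1 ∈ [d]):
-- B_j = B \ {b_j}, [n] \ B_j = {x_1 < … < x_{n-d+1}}, entries B_j ∪ {x_k}.
series : ℕ → (B : List ℕ) → Fin (length B) → List (List ℕ)
series n B j =
  let Bj = removeAt B j in
  map (λ x → ins x Bj) (filter (λ x → ¬? (x ∈? Bj)) (oneTo n))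

changes : List Sign → ℕ
changes [] = 0
changes (x ∷ []) = 0
changes (plus ∷ plus ∷ xs) = changes (plus ∷ xs)
changes (minus ∷ minus ∷ xs) = changes (minus ∷ xs)
changes (plus ∷ minus ∷ xs) = suc (changes (minus ∷ xs))
changes (minus ∷ plus ∷ xs) = suc (changes (plus ∷ xs))

-- d-co-signotope on n elements (τ is given on all lists; only its values on d-subsets matter)
IsCoSignotope : ℕ → ℕ → (List ℕ → Sign) → Set
IsCoSignotope n d τ =
  ∀ B → IsDSubset n d B → ∀ (j : Fin (length B)) → changes (map τ (series n B j)) ≤ 1

HasPlusCount : ℕ → ℕ → (List ℕ → Sign) → ℕ → Set
HasPlusCount n d τ p =
  Σ (List (List ℕ)) λ L → length L ≡ p × AllPairs _≢_ L ×
    (∀ R → (R ∈ L) ⇔ (IsDSubset n d R × τ R ≡ plus))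

InSbar : ℕ → ℕ → ℕ → (List ℕ → Sign) → Set
InSbar p n d τ = IsCoSignotope n d τ × HasPlusCount n d τ p

data Consec {A : Set} : List A → A → A → Set where
  here  : ∀ {x y rest} → Consec (x ∷ y ∷ rest) x y
  there : ∀ {z rest x y} → Consec rest x y → Consec (z ∷ rest) x y

SeriesStep : ℕ → ℕ → List ℕ → List ℕ → Set
SeriesStep n d R R' = ∃ λ B → IsDSubset n d B × ∃ λ (j : Fin (length B)) → Consec (series n B j) R R'

Adj : ℕ → ℕ → List ℕ → List ℕ → Set
Adj n d R R' = SeriesStep n d R R' ⊎ SeriesStep n d R' R

PlusEdge : ℕ → ℕ → (List ℕ → Sign) → List ℕ → List ℕ → Set
PlusEdge n d τ R R' = Adj n d R R' × τ R ≡ plus × τ R' ≡ plus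

SameComp : ℕ → ℕ → (List ℕ → Sign) → List ℕ → List ℕ → Set
SameComp n d τ R R' =
  IsDSubset n d R × τ R ≡ plus × IsDSubset n d R' × τ R' ≡ plus × Star (PlusEdge n d τ) R R'

range : ℕ → ℕ → List ℕ
range a len = map (a +_) (upTo len)

-- source subset S_{n,d,i} = {1,…,i} ∪ {n-d+i+1,…,n}
source : ℕ → ℕ → ℕ → List ℕ
source n d i = range 1 i ++ range (n ∸ d + i + 1) (d ∸ i)

-- A d-subset is recorded by its complement in [n], listed increasingly. Along an edge of G_{n,d}
-- exactly one entry of that list changes, whereas the complements of two different sources differ
-- in all n − d entries. On a path between two sources, the vertices at which the individual entries
-- first change are therefore n − d distinct +-subsets other than the starting source, and with it
-- they exceed the p ≤ n − d +-subsets available.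
--
-- For existence, keep a window (a, e] with [1, a] ⊆ R and [e + 1, n] ⊆ R. If R misses the window,
-- then R = S_{n,d,a}. Otherwise take y ∈ R inside it, where a + 1, e ∉ R (else narrow the window),
-- and consider the (R, j)-series at the position j of y: it passes through R[y ↦ a + 1], R and
-- R[y ↦ e] in this order and changes sign at most once, so one of the two stretches next to R is
-- entirely +. Hence R is joined within its +-component to a +-subset with a narrower window.

module Submission where

open import Defs
open import Data.Nat using (ℕ; zero; suc; _+_; _∸_; _≤_; _<_; _≤ᵇ_; z≤n; s≤s)
open import Data.Nat.Properties
open import Data.Bool using (true; false; T)
import Data.Fin as Fin
open import Data.List using (List; []; _∷_; [_]; _++_; map; filter; upTo; applyUpTo; length; removeAt)
open import Data.List.Properties using (map-++; ++-assoc; length-++; length-map; length-upTo; length-removeAt′; map-applyUpTo)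
open import Data.List.Relation.Unary.All as All using (All; []; _∷_)
import Data.List.Relation.Unary.All.Properties as All
open import Data.List.Relation.Unary.Any using (here; there; index; _─_; any?)
open import Data.List.Relation.Unary.AllPairs as AllPairs using (AllPairs; []; _∷_)
import Data.List.Relation.Unary.AllPairs.Properties as AllPairs
open import Data.List.Relation.Unary.Linked as Linked using (Linked; []; [-]; _∷_)
import Data.List.Relation.Unary.Linked.Properties as Linked
open import Data.List.Relation.Unary.Unique.Propositional using (Unique)
import Data.List.Relation.Unary.Unique.Propositional.Properties as Unique
open import Data.List.Relation.Binary.Subset.Propositional using (_⊆_)
open import Data.List.Membership.Propositional using (_∈_; _∉_; find; lose)
open import Data.List.Membership.Propositional.Properties
  using (∈-∃++; ∈-++⁺ˡ; ∈-++⁺ʳ; ∈-++⁻; ∈-map⁺; ∈-map⁻; ∈-upTo⁺; ∈-upTo⁻; ∈-filter⁺; ∈-filter⁻)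
open import Data.List.Membership.DecPropositional _≟_ using (_∈?_)
open import Data.Product as Product using (Σ; ∃; ∃₂; _×_; _,_; proj₁; proj₂)
open import Data.Sum as Sum using (_⊎_; inj₁; inj₂; [_,_]′)
open import Data.Empty using (⊥-elim)
open import Relation.Nullary using (¬_; ¬?; yes; no; _×-dec_)
open import Relation.Nullary.Decidable using (decidable-stable)
open import Relation.Binary.Definitions using (Symmetric)
open import Relation.Binary.Construct.Closure.ReflexiveTransitive using (Star; ε; _◅_; _◅◅_; reverse)
open import Relation.Binary.PropositionalEquality
  using (_≡_; _≢_; refl; sym; trans; cong; cong₂; subst; subst₂; ≢-sym; module ≡-Reasoning)
open import Function using (_∘_)
open import Function.Bundles using (Equivalence)

private
  variable
    A : Set
    x y z : A
    xs ys : List A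

∈-removeAt⁻ : ∀ (xs : List A) j → z ∈ removeAt xs j → z ∈ xs
∈-removeAt⁻ (_ ∷ _)  Fin.zero    z∈ = there z∈
∈-removeAt⁻ (_ ∷ _)  (Fin.suc j) (here refl) = here refl
∈-removeAt⁻ (_ ∷ xs) (Fin.suc j) (there z∈) = there (∈-removeAt⁻ xs j z∈)

removeAt⁺ : ∀ {R : A → A → Set} (xs : List A) j → AllPairs R xs → AllPairs R (removeAt xs j)
removeAt⁺ (_ ∷ _)  Fin.zero    (_ ∷ rs)  = rs
removeAt⁺ (_ ∷ xs) (Fin.suc j) (r ∷ rs) = All.tabulate (All.lookup r ∘ ∈-removeAt⁻ xs j) ∷ removeAt⁺ xs j rs

∈-─⁺ : (x∈ : x ∈ xs) → z ∈ xs → z ≢ x → z ∈ (xs ─ x∈)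
∈-─⁺ (here refl) (here refl) z≢x = ⊥-elim (z≢x refl)
∈-─⁺ (here refl) (there z∈)  _   = z∈
∈-─⁺ (there x∈)  (here refl) _   = here refl
∈-─⁺ (there x∈)  (there z∈)  z≢x = there (∈-─⁺ x∈ z∈ z≢x)

∉-─ : Unique xs → (x∈ : x ∈ xs) → x ∉ (xs ─ x∈)
∉-─ (u ∷ _)  (here refl) x∈′        = All.lookup u x∈′ refl
∉-─ (u ∷ _)  (there x∈)  (here refl) = All.lookup u x∈ refl
∉-─ (_ ∷ us) (there x∈)  (there x∈′) = ∉-─ us x∈ x∈′

unique-⊆⇒length≤ : Unique xs → xs ⊆ ys → length xs ≤ length ys
unique-⊆⇒length≤ {xs = []}     _         _   = z≤n
unique-⊆⇒length≤ {xs = x ∷ xs} {ys} (x≢ ∷ u) sub = begin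
  suc (length xs)          ≤⟨ s≤s (unique-⊆⇒length≤ u (λ z∈ → ∈-─⁺ x∈ys (sub (there z∈)) (≢-sym (All.lookup x≢ z∈)))) ⟩
  suc (length (ys ─ x∈ys)) ≡⟨ length-removeAt′ ys (index x∈ys) ⟨
  length ys                ∎
  where
  open ≤-Reasoning
  x∈ys = sub (here refl)

∈-middle : ∀ (pre : List A) {rest} → x ∈ pre ++ x ∷ rest
∈-middle []        = here refl
∈-middle (_ ∷ pre) = there (∈-middle pre)

─-middle : ∀ (pre : List A) {rest} → ((pre ++ x ∷ rest) ─ ∈-middle pre) ≡ pre ++ rest
─-middle []        = refl
─-middle (p ∷ pre) = cong (p ∷_) (─-middle pre)

Linked-++⁻ˡ : ∀ {R : A → A → Set} xs → Linked R (xs ++ ys) → Linked R xs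
Linked-++⁻ˡ []           _       = []
Linked-++⁻ˡ (_ ∷ [])     _       = [-]
Linked-++⁻ˡ (_ ∷ y ∷ xs) (r ∷ l) = r ∷ Linked-++⁻ˡ (y ∷ xs) l

Linked-++⁻ʳ : ∀ {R : A → A → Set} xs → Linked R (xs ++ ys) → Linked R ys
Linked-++⁻ʳ []       l = l
Linked-++⁻ʳ (_ ∷ xs) l = Linked-++⁻ʳ xs (Linked.tail l)

module _ {E : A → A → Set} (E-sym : Symmetric E) where

  linked⇒star-from-head : Linked E (x ∷ xs) → y ∈ x ∷ xs → Star E x y
  linked⇒star-from-head _       (here refl) = ε
  linked⇒star-from-head (e ∷ l) (there y∈)  = e ◅ linked⇒star-from-head l y∈
  linked⇒star-from-head [-]     (there ())

  linked⇒connected : Linked E xs → x ∈ xs → y ∈ xs → Star E x y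
  linked⇒connected {xs = _ ∷ _} l x∈ y∈ =
    reverse E-sym (linked⇒star-from-head l x∈) ◅◅ linked⇒star-from-head l y∈

consec-linked : ∀ (xs : List A) → Linked (Consec xs) xs
consec-linked []           = []
consec-linked (_ ∷ [])     = [-]
consec-linked (_ ∷ y ∷ xs) = here ∷ Linked.map there (consec-linked (y ∷ xs))

consec-map⁻ : ∀ {B : Set} (f : A → B) xs {u v} → Consec (map f xs) u v →
  ∃ λ pre → ∃₂ λ a b → ∃ λ post → xs ≡ pre ++ a ∷ b ∷ post × u ≡ f a × v ≡ f b
consec-map⁻ f (x ∷ y ∷ xs) here = [] , x , y , xs , refl , refl , refl
consec-map⁻ f (x ∷ xs) (there c) with consec-map⁻ f xs c
... | pre , a , b , post , refl , u≡ , v≡ = x ∷ pre , a , b , post , refl , u≡ , v≡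

Sorted : List ℕ → Set
Sorted = AllPairs _<_

sorted⇒unique : ∀ {xs} → Sorted xs → Unique xs
sorted⇒unique = AllPairs.map <⇒≢

sorted-⊆⊇⇒≡ : ∀ {xs ys} → Sorted xs → Sorted ys → xs ⊆ ys → ys ⊆ xs → xs ≡ ys
sorted-⊆⊇⇒≡ {[]}     {[]}     _ _ _ _ = refl
sorted-⊆⊇⇒≡ {[]}     {_ ∷ _}  _ _ _ ys⊆ with () ← ys⊆ (here refl)
sorted-⊆⊇⇒≡ {_ ∷ _}  {[]}     _ _ xs⊆ _ with () ← xs⊆ (here refl)
sorted-⊆⊇⇒≡ {x ∷ xs} {y ∷ ys} (x< ∷ sx) (y< ∷ sy) xs⊆ ys⊆ with xs⊆ (here refl) | ys⊆ (here refl)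
... | here refl  | _          = cong (x ∷_) (sorted-⊆⊇⇒≡ sx sy (tail⊆ x< xs⊆) (tail⊆ y< ys⊆))
  where
  tail⊆ : ∀ {x xs ys} → All (x <_) xs → x ∷ xs ⊆ x ∷ ys → xs ⊆ ys
  tail⊆ x< sub z∈ with sub (there z∈)
  ... | here refl = ⊥-elim (<-irrefl refl (All.lookup x< z∈))
  ... | there z∈′ = z∈′
... | there x∈ys | here refl  = ⊥-elim (<-irrefl refl (All.lookup y< x∈ys))
... | there x∈ys | there y∈xs = ⊥-elim (<-asym (All.lookup x< y∈xs) (All.lookup y< x∈ys))

∈-ins⁻ : ∀ x ys {z} → z ∈ ins x ys → z ≡ x ⊎ z ∈ ys
∈-ins⁻ x []       (here z≡x) = inj₁ z≡x
∈-ins⁻ x (y ∷ ys) z∈ with x ≤ᵇ y | z∈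
... | true  | here z≡x  = inj₁ z≡x
... | true  | there z∈′ = inj₂ z∈′
... | false | here z≡y  = inj₂ (here z≡y)
... | false | there z∈′ = Sum.map₂ there (∈-ins⁻ x ys z∈′)

∈-ins⁺ˡ : ∀ x ys → x ∈ ins x ys
∈-ins⁺ˡ x []       = here refl
∈-ins⁺ˡ x (y ∷ ys) with x ≤ᵇ y
... | true  = here refl
... | false = there (∈-ins⁺ˡ x ys)

∈-ins⁺ʳ : ∀ x {ys z} → z ∈ ys → z ∈ ins x ys
∈-ins⁺ʳ x {y ∷ ys} z∈ with x ≤ᵇ y | z∈
... | true  | _         = there z∈
... | false | here z≡y  = here z≡y
... | false | there z∈′ = there (∈-ins⁺ʳ x z∈′)

length-ins : ∀ x ys → length (ins x ys) ≡ suc (length ys)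
length-ins x []       = refl
length-ins x (y ∷ ys) with x ≤ᵇ y
... | true  = refl
... | false = cong suc (length-ins x ys)

ins⁺ : ∀ x {ys} → Sorted ys → x ∉ ys → Sorted (ins x ys)
ins⁺ x {[]}     _         _  = [] ∷ []
ins⁺ x {y ∷ ys} (y< ∷ sy) x∉ with x ≤ᵇ y in x≤ᵇy
... | true  = (x<y ∷ All.map (<-trans x<y) y<) ∷ y< ∷ sy
  where x<y = ≤∧≢⇒< (≤ᵇ⇒≤ x y (subst T (sym x≤ᵇy) _)) (x∉ ∘ here)
... | false = All.tabulate (λ z∈ → [ (λ { refl → y<x }) , All.lookup y< ]′ (∈-ins⁻ x ys z∈))
            ∷ ins⁺ x sy (x∉ ∘ there)
  where y<x = ≰⇒> (subst T x≤ᵇy ∘ ≤⇒≤ᵇ)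

ins-─ : ∀ {xs y} → Sorted xs → (y∈ : y ∈ xs) → ins y (xs ─ y∈) ≡ xs
ins-─ {xs} {y} sxs y∈ = sorted-⊆⊇⇒≡ (ins⁺ y (removeAt⁺ xs _ sxs) (∉-─ (sorted⇒unique sxs) y∈)) sxs ins⊆ ⊆ins
  where
  ins⊆ : ins y (xs ─ y∈) ⊆ xs
  ins⊆ z∈ = [ (λ { refl → y∈ }) , ∈-removeAt⁻ xs _ ]′ (∈-ins⁻ y _ z∈)
  ⊆ins : xs ⊆ ins y (xs ─ y∈)
  ⊆ins {z} z∈ with z ≟ y
  ... | yes refl = ∈-ins⁺ˡ y (xs ─ y∈)
  ... | no z≢y   = ∈-ins⁺ʳ y (∈-─⁺ y∈ z∈ z≢y)

∈-range⁻ : ∀ a len {z} → z ∈ range a len → a ≤ z × z < a + len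
∈-range⁻ a len z∈ with k , k∈ , refl ← ∈-map⁻ (a +_) z∈ = m≤m+n a k , +-monoʳ-< a (∈-upTo⁻ k∈)

∈-range⁺ : ∀ a len {z} → a ≤ z → z < a + len → z ∈ range a len
∈-range⁺ a len {z} a≤z z<a+len = subst (_∈ range a len) (m+[n∸m]≡n a≤z)
  (∈-map⁺ (a +_) (∈-upTo⁺ (+-cancelˡ-< a _ _ (subst (_< a + len) (sym (m+[n∸m]≡n a≤z)) z<a+len))))

range-sorted : ∀ a len → Sorted (range a len)
range-sorted a len = AllPairs.map⁺ (AllPairs.applyUpTo⁺₁ (λ i → i) len (λ i<j _ → +-monoʳ-< a i<j))

length-range : ∀ a len → length (range a len) ≡ len
length-range a len = trans (length-map (a +_) (upTo len)) (length-upTo len)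

-- Out-of-range positions read as 0; only positions below the length are ever used.
nth : ℕ → List ℕ → ℕ
nth _       []       = 0
nth zero    (x ∷ _)  = x
nth (suc t) (_ ∷ xs) = nth t xs

nth-applyUpTo : ∀ f len {t} → t < len → nth t (applyUpTo f len) ≡ f t
nth-applyUpTo f (suc len) {zero}  _           = refl
nth-applyUpTo f (suc len) {suc t} (s≤s t<len) = nth-applyUpTo (f ∘ suc) len t<len

nth-range : ∀ a len {t} → t < len → nth t (range a len) ≡ a + t
nth-range a len t<len = trans (cong (nth _) (map-applyUpTo (λ i → i) (a +_) len)) (nth-applyUpTo (a +_) len t<len)

nth-++-∷ : ∀ pre {a b post t} → t ≢ length pre → nth t (pre ++ a ∷ post) ≡ nth t (pre ++ b ∷ post)
nth-++-∷ []        {t = zero}  t≢ = ⊥-elim (t≢ refl)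
nth-++-∷ []        {t = suc t} _  = refl
nth-++-∷ (_ ∷ pre) {t = zero}  _  = refl
nth-++-∷ (_ ∷ pre) {t = suc t} t≢ = nth-++-∷ pre (t≢ ∘ cong suc)

complement : ℕ → List ℕ → List ℕ
complement n B = filter (λ x → ¬? (x ∈? B)) (oneTo n)

∈-complement⁻ : ∀ n B {z} → z ∈ complement n B → (1 ≤ z × z ≤ n) × z ∉ B
∈-complement⁻ n B z∈ with z∈[1,n] , z∉B ← ∈-filter⁻ (λ x → ¬? (x ∈? B)) {xs = oneTo n} z∈ =
  Product.map₂ ≤-pred (∈-range⁻ 1 n z∈[1,n]) , z∉B

∈-complement⁺ : ∀ n B {z} → 1 ≤ z → z ≤ n → z ∉ B → z ∈ complement n B
∈-complement⁺ n B 1≤z z≤max = ∈-filter⁺ (λ x → ¬? (x ∈? B)) (∈-range⁺ 1 n 1≤z (s≤s z≤max))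

complement-sorted : ∀ n B → Sorted (complement n B)
complement-sorted n B = AllPairs.filter⁺ (λ x → ¬? (x ∈? B)) (range-sorted 1 n)

complement-ins : ∀ n B pre {a} rest → complement n B ≡ pre ++ a ∷ rest → complement n (ins a B) ≡ pre ++ rest
complement-ins n B pre {a} rest X≡ = sorted-⊆⊇⇒≡ (complement-sorted n (ins a B)) rest-sorted ⊆rest rest⊆
  where
  X-sorted : Sorted (pre ++ a ∷ rest)
  X-sorted = subst Sorted X≡ (complement-sorted n B)
  rest-sorted : Sorted (pre ++ rest)
  rest-sorted = subst Sorted (─-middle pre) (removeAt⁺ _ _ X-sorted)
  ⊆rest : complement n (ins a B) ⊆ pre ++ rest
  ⊆rest z∈ with (1≤z , z≤max) , z∉ ← ∈-complement⁻ n (ins a B) z∈ =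
    subst (_ ∈_) (─-middle pre) (∈-─⁺ (∈-middle pre)
      (subst (_ ∈_) X≡ (∈-complement⁺ n B 1≤z z≤max (z∉ ∘ ∈-ins⁺ʳ a)))
      (λ { refl → z∉ (∈-ins⁺ˡ a B) }))
  rest⊆ : pre ++ rest ⊆ complement n (ins a B)
  rest⊆ z∈ =
    let z∈′ = subst (_ ∈_) (sym (─-middle pre)) z∈
        (1≤z , z≤max) , z∉B = ∈-complement⁻ n B (subst (_ ∈_) (sym X≡) (∈-removeAt⁻ _ _ z∈′))
    in ∈-complement⁺ n (ins a B) 1≤z z≤max
         ([ (λ { refl → ∉-─ (sorted⇒unique X-sorted) (∈-middle pre) z∈′ }) , z∉B ]′ ∘ ∈-ins⁻ a B)

dsubset-sorted : ∀ {n d B} → IsDSubset n d B → Sorted B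
dsubset-sorted (B↑ , _ , _) = Linked.Linked⇒AllPairs <-trans B↑

entry-dsubset : ∀ {n d} B → IsDSubset n d B → ∀ j {x} → x ∈ complement n (removeAt B j) →
  IsDSubset n d (ins x (removeAt B j))
entry-dsubset {n} B dB@(_ , bounds , |B|) j {x} x∈ =
  Linked.AllPairs⇒Linked (ins⁺ x (removeAt⁺ B j (dsubset-sorted dB)) (proj₂ x∈′)) ,
  All.tabulate (λ z∈ → [ (λ { refl → proj₁ x∈′ }) , All.lookup bounds ∘ ∈-removeAt⁻ B j ]′ (∈-ins⁻ x _ z∈)) ,
  trans (length-ins x (removeAt B j)) (trans (sym (length-removeAt′ B j)) |B|)
  where x∈′ = ∈-complement⁻ n (removeAt B j) x∈

position : ℕ → List ℕ → ℕ → ℕ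
position n R t = nth t (complement n R)

DifferInAtMostOne : (ℕ → ℕ) → (ℕ → ℕ) → Set
DifferInAtMostOne f g = ∃ λ t₀ → ∀ {t} → t ≢ t₀ → f t ≡ g t

step-positions : ∀ {n d R R'} → SeriesStep n d R R' → DifferInAtMostOne (position n R) (position n R')
step-positions {n} (B , _ , j , c)
  with pre , a , b , post , X≡ , refl , refl ← consec-map⁻ (λ x → ins x (removeAt B j)) (complement n (removeAt B j)) c =
  length pre , λ {t} t≢ → begin
    nth t (complement n (ins a Bj)) ≡⟨ cong (nth t) (complement-ins n Bj pre (b ∷ post) X≡) ⟩
    nth t (pre ++ b ∷ post)         ≡⟨ nth-++-∷ pre t≢ ⟩
    nth t (pre ++ a ∷ post)         ≡⟨ cong (nth t) (trans (complement-ins n Bj (pre ++ [ a ]) post X≡′) (++-assoc pre [ a ] post)) ⟨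
    nth t (complement n (ins b Bj)) ∎
  where
  open ≡-Reasoning
  Bj = removeAt B j
  X≡′ = trans X≡ (sym (++-assoc pre [ a ] (b ∷ post)))

step-dsubsets : ∀ {n d R R'} → SeriesStep n d R R' → IsDSubset n d R × IsDSubset n d R'
step-dsubsets {n} (B , dB , j , c)
  with pre , a , b , post , X≡ , refl , refl ← consec-map⁻ (λ x → ins x (removeAt B j)) (complement n (removeAt B j)) c =
  entry-dsubset B dB j (subst (a ∈_) (sym X≡) (∈-middle pre)) ,
  entry-dsubset B dB j (subst (b ∈_) (sym X≡) (∈-++⁺ʳ pre (there (here refl))))

adj-positions : ∀ {n d R R'} → Adj n d R R' → DifferInAtMostOne (position n R) (position n R')
adj-positions (inj₁ step) = step-positions step
adj-positions (inj₂ step) with t₀ , same ← step-positions step = t₀ , sym ∘ same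

adj-dsubsets : ∀ {n d R R'} → Adj n d R R' → IsDSubset n d R × IsDSubset n d R'
adj-dsubsets (inj₁ step) = step-dsubsets step
adj-dsubsets (inj₂ step) = Product.swap (step-dsubsets step)

series-linked : ∀ {n d B} → IsDSubset n d B → ∀ j → Linked (SeriesStep n d) (series n B j)
series-linked {n} {d} {B} dB j = Linked.map (λ c → B , dB , j , c) (consec-linked (series n B j))

PlusSubset : ℕ → ℕ → (List ℕ → Sign) → List ℕ → Set
PlusSubset n d τ R = IsDSubset n d R × τ R ≡ plus

module _ {n d : ℕ} {τ : List ℕ → Sign} where

  plus-edge-sym : Symmetric (PlusEdge n d τ)
  plus-edge-sym (adj , τR , τR') = Sum.swap adj , τR' , τR

  plus-edge-target : ∀ {R R'} → PlusEdge n d τ R R' → PlusSubset n d τ R'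
  plus-edge-target (adj , _ , τR') = proj₂ (adj-dsubsets adj) , τR'

  star-plus : ∀ {R R'} → Star (PlusEdge n d τ) R R' → PlusSubset n d τ R → PlusSubset n d τ R'
  star-plus ε          pR = pR
  star-plus (e ◅ path) _  = star-plus path (plus-edge-target e)

  plus-linked : ∀ {Rs} → Linked (SeriesStep n d) Rs → All (λ R → τ R ≡ plus) Rs → Linked (PlusEdge n d τ) Rs
  plus-linked []       _                          = []
  plus-linked [-]      _                          = [-]
  plus-linked (s ∷ ss) (τR ∷ τRs@(τR' ∷ _)) = (inj₁ s , τR , τR') ∷ plus-linked ss τRs

changes-∷ : ∀ s ss → changes ss ≤ changes (s ∷ ss)
changes-∷ _     []          = z≤n
changes-∷ plus  (plus ∷ _)  = ≤-refl
changes-∷ plus  (minus ∷ _) = n≤1+n _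
changes-∷ minus (plus ∷ _)  = n≤1+n _
changes-∷ minus (minus ∷ _) = ≤-refl

changes-++ : ∀ ss ts → changes ts ≤ changes (ss ++ ts)
changes-++ []       ts = ≤-refl
changes-++ (s ∷ ss) ts = ≤-trans (changes-++ ss ts) (changes-∷ s (ss ++ ts))

changes-plus⋯minus : ∀ ss ts → 1 ≤ changes (plus ∷ ss ++ minus ∷ ts)
changes-plus⋯minus []           _ = s≤s z≤n
changes-plus⋯minus (plus ∷ ss)  ts = changes-plus⋯minus ss ts
changes-plus⋯minus (minus ∷ _)  _ = s≤s z≤n

changes-minus⋯plus : ∀ ss ts → suc (changes (plus ∷ ts)) ≤ changes (minus ∷ ss ++ plus ∷ ts)
changes-minus⋯plus []           ts = ≤-refl
changes-minus⋯plus (plus ∷ ss)  ts = s≤s (changes-++ (plus ∷ ss) (plus ∷ ts))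
changes-minus⋯plus (minus ∷ ss) ts = changes-minus⋯plus ss ts

all-plus⊎minus∈ : ∀ ss → All (_≡ plus) ss ⊎ minus ∈ ss
all-plus⊎minus∈ []           = inj₁ []
all-plus⊎minus∈ (minus ∷ _)  = inj₂ (here refl)
all-plus⊎minus∈ (plus ∷ ss)  = Sum.map (refl ∷_) there (all-plus⊎minus∈ ss)

changes≤1-split : ∀ ss ts → changes (ss ++ plus ∷ ts) ≤ 1 → All (_≡ plus) ss ⊎ All (_≡ plus) ts
changes≤1-split ss ts ≤1 with all-plus⊎minus∈ ss | all-plus⊎minus∈ ts
... | inj₁ all⁺ | _         = inj₁ all⁺
... | inj₂ _    | inj₁ all⁺ = inj₂ all⁺
... | inj₂ m∈ss | inj₂ m∈ts
  with A , B , refl ← ∈-∃++ m∈ss | C , D , refl ← ∈-∃++ m∈ts = ⊥-elim (1+n≰n (≤-trans two-changes ≤1))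
  where
  open ≤-Reasoning
  two-changes : 2 ≤ changes ((A ++ minus ∷ B) ++ plus ∷ C ++ minus ∷ D)
  two-changes = begin
    2                                                   ≤⟨ s≤s (changes-plus⋯minus C D) ⟩
    suc (changes (plus ∷ C ++ minus ∷ D))               ≤⟨ changes-minus⋯plus B (C ++ minus ∷ D) ⟩
    changes (minus ∷ B ++ plus ∷ C ++ minus ∷ D)        ≤⟨ changes-++ A _ ⟩
    changes (A ++ minus ∷ B ++ plus ∷ C ++ minus ∷ D)   ≡⟨ cong changes (++-assoc A (minus ∷ B) _) ⟨
    changes ((A ++ minus ∷ B) ++ plus ∷ C ++ minus ∷ D) ∎

infix 4 [_,_]⊆_
[_,_]⊆_ : ℕ → ℕ → List ℕ → Set
[ l , h ]⊆ R = ∀ {x} → l ≤ x → x ≤ h → x ∈ R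

⊆-extendʳ : ∀ {l h R} → [ l , h ]⊆ R → suc h ∈ R → [ l , suc h ]⊆ R
⊆-extendʳ I h+1∈ l≤x x≤h+1 with m≤n⇒m<n∨m≡n x≤h+1
... | inj₁ (s≤s x≤h) = I l≤x x≤h
... | inj₂ refl      = h+1∈

⊆-extendˡ : ∀ {l h R} → l ∈ R → [ suc l , h ]⊆ R → [ l , h ]⊆ R
⊆-extendˡ l∈ I l≤x x≤h with m≤n⇒m<n∨m≡n l≤x
... | inj₁ l<x  = I l<x x≤h
... | inj₂ refl = l∈

infix 6 _[_↦_]
_[_↦_] : ∀ {y} (B : List ℕ) → y ∈ B → ℕ → List ℕ
B [ y∈ ↦ x ] = ins x (B ─ y∈)

⊆-↦ : ∀ {l h R y} (y∈ : y ∈ R) w → [ l , h ]⊆ R → y < l ⊎ h < y → [ l , h ]⊆ R [ y∈ ↦ w ]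
⊆-↦ y∈ w I y∉[l,h] l≤x x≤h = ∈-ins⁺ʳ w (∈-─⁺ y∈ (I l≤x x≤h) λ { refl →
  [ (λ y<l → <-irrefl refl (<-≤-trans y<l l≤x)) , (λ h<y → <-irrefl refl (≤-<-trans x≤h h<y)) ]′ y∉[l,h] })

gapless⇒source : ∀ {n d R a e} → IsDSubset n d R → [ 1 , a ]⊆ R → [ suc e , n ]⊆ R → a ≤ e → e ≤ n →
  (∀ {x} → x ∈ R → a < x → e < x) → a ≤ d × R ≡ source n d a
gapless⇒source {n} {d} {R} {a} {e} dR@(_ , bounds , |R|) lead trail a≤e e≤n gapless =
  subst (a ≤_) (sym d≡) (m≤m+n a k) , trans R≡U (cong₂ (λ s l → range 1 a ++ range s l) start≡ (sym |trail|≡))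
  where
  k = n ∸ e
  U = range 1 a ++ range (suc e) k
  n+1≡ : suc e + k ≡ suc n
  n+1≡ = cong suc (m+[n∸m]≡n e≤n)
  U-sorted : Sorted U
  U-sorted = AllPairs.++⁺ (range-sorted 1 a) (range-sorted (suc e) k) (All.tabulate λ x∈ → All.tabulate λ y∈ →
    ≤-trans (s≤s (≤-trans (≤-pred (proj₂ (∈-range⁻ 1 a x∈))) a≤e)) (proj₁ (∈-range⁻ (suc e) k y∈)))
  R⊆U : R ⊆ U
  R⊆U {x} x∈ with x ≤? a
  ... | yes x≤a = ∈-++⁺ˡ (∈-range⁺ 1 a (proj₁ (All.lookup bounds x∈)) (s≤s x≤a))
  ... | no x≰a  = ∈-++⁺ʳ _ (∈-range⁺ (suc e) k (gapless x∈ (≰⇒> x≰a))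
                    (subst (x <_) (sym n+1≡) (s≤s (proj₂ (All.lookup bounds x∈)))))
  U⊆R : U ⊆ R
  U⊆R {x} x∈ with ∈-++⁻ (range 1 a) x∈
  ... | inj₁ x∈ˡ = lead (proj₁ (∈-range⁻ 1 a x∈ˡ)) (≤-pred (proj₂ (∈-range⁻ 1 a x∈ˡ)))
  ... | inj₂ x∈ʳ = trail (proj₁ (∈-range⁻ (suc e) k x∈ʳ)) (≤-pred (subst (x <_) n+1≡ (proj₂ (∈-range⁻ (suc e) k x∈ʳ))))
  R≡U : R ≡ U
  R≡U = sorted-⊆⊇⇒≡ (dsubset-sorted dR) U-sorted R⊆U U⊆R
  d≡ : d ≡ a + k
  d≡ = begin
    d                                      ≡⟨ |R| ⟨
    length R                               ≡⟨ cong length R≡U ⟩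
    length U                               ≡⟨ length-++ (range 1 a) ⟩
    length (range 1 a) + length (range (suc e) k) ≡⟨ cong₂ _+_ (length-range 1 a) (length-range (suc e) k) ⟩
    a + k                                  ∎
    where open ≡-Reasoning
  |trail|≡ : d ∸ a ≡ k
  |trail|≡ = trans (cong (_∸ a) d≡) (m+n∸m≡n a k)
  start≡ : suc e ≡ n ∸ d + a + 1
  start≡ = sym (begin
    n ∸ d + a + 1       ≡⟨ cong (λ m → n ∸ m + a + 1) (trans d≡ (+-comm a k)) ⟩
    n ∸ (k + a) + a + 1 ≡⟨ cong (λ m → m + a + 1) (∸-+-assoc n k a) ⟨
    n ∸ k ∸ a + a + 1   ≡⟨ cong (λ m → m ∸ a + a + 1) (m∸[m∸n]≡n e≤n) ⟩
    e ∸ a + a + 1       ≡⟨ cong (_+ 1) (m∸n+n≡m a≤e) ⟩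
    e + 1               ≡⟨ +-comm e 1 ⟩
    suc e               ∎)
    where open ≡-Reasoning

complement-source : ∀ {n d i} → d < n → i ≤ d → complement n (source n d i) ≡ range (suc i) (n ∸ d)
complement-source {n} {d} {i} d<n i≤d =
  sorted-⊆⊇⇒≡ (complement-sorted n S) (range-sorted (suc i) m) C⊆ ⊆C
  where
  open ≡-Reasoning
  m = n ∸ d
  S = source n d i
  start≡ : m + i + 1 ≡ suc i + m
  start≡ = trans (+-comm (m + i) 1) (cong suc (+-comm m i))
  end≡ : m + i + 1 + (d ∸ i) ≡ suc n
  end≡ = begin
    m + i + 1 + (d ∸ i)   ≡⟨ cong (_+ (d ∸ i)) start≡ ⟩
    suc (i + m + (d ∸ i)) ≡⟨ cong (λ x → suc (x + (d ∸ i))) (+-comm i m) ⟩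
    suc (m + i + (d ∸ i)) ≡⟨ cong suc (+-assoc m i (d ∸ i)) ⟩
    suc (m + (i + (d ∸ i))) ≡⟨ cong (λ x → suc (m + x)) (m+[n∸m]≡n i≤d) ⟩
    suc (m + d)           ≡⟨ cong suc (m∸n+n≡m (<⇒≤ d<n)) ⟩
    suc n                 ∎
  C⊆ : complement n S ⊆ range (suc i) m
  C⊆ {z} z∈ with (1≤z , z≤max) , z∉S ← ∈-complement⁻ n S z∈ = ∈-range⁺ (suc i) m
    (≰⇒> λ z≤i → z∉S (∈-++⁺ˡ (∈-range⁺ 1 i 1≤z (s≤s z≤i))))
    (≰⇒> λ i+m<z → z∉S (∈-++⁺ʳ (range 1 i) (∈-range⁺ (m + i + 1) (d ∸ i) (subst (_≤ z) (sym start≡) i+m<z)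
      (subst (z <_) (sym end≡) (s≤s z≤max)))))
  ⊆C : range (suc i) m ⊆ complement n S
  ⊆C {z} z∈ with i<z , z<i+m ← ∈-range⁻ (suc i) m z∈ =
    ∈-complement⁺ n S (≤-trans (s≤s z≤n) i<z) z≤max ([ z∉front , z∉back ]′ ∘ ∈-++⁻ (range 1 i))
    where
    z≤max : z ≤ n
    z≤max = ≤-pred (≤-trans z<i+m (subst₂ _≤_ start≡ end≡ (m≤m+n (m + i + 1) (d ∸ i))))
    z∉front : z ∉ range 1 i
    z∉front z∈ = <-irrefl refl (<-≤-trans (proj₂ (∈-range⁻ 1 i z∈)) i<z)
    z∉back : z ∉ range (m + i + 1) (d ∸ i)
    z∉back z∈ = <-irrefl refl (<-≤-trans z<i+m (subst (_≤ z) start≡ (proj₁ (∈-range⁻ (m + i + 1) (d ∸ i) z∈))))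

position-source : ∀ {n d i t} → d < n → i ≤ d → t < n ∸ d → position n (source n d i) t ≡ suc i + t
position-source {n} {d} {i} d<n i≤d t<m = trans (cong (nth _) (complement-source d<n i≤d)) (nth-range (suc i) (n ∸ d) t<m)

∈-++-∷⁻ˡ : ∀ pre {y post u} → Sorted (pre ++ y ∷ post) → u ∈ pre ++ y ∷ post → u < y → u ∈ pre
∈-++-∷⁻ˡ []        _         (here refl) u<y = ⊥-elim (<-irrefl refl u<y)
∈-++-∷⁻ˡ []        (y< ∷ _)  (there u∈)  u<y = ⊥-elim (<-asym u<y (All.lookup y< u∈))
∈-++-∷⁻ˡ (_ ∷ pre) _         (here refl) _   = here refl
∈-++-∷⁻ˡ (_ ∷ pre) (_ ∷ s)   (there u∈)  u<y = there (∈-++-∷⁻ˡ pre s u∈ u<y)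

∈-++-∷⁻ʳ : ∀ pre {y post u} → Sorted (pre ++ y ∷ post) → u ∈ pre ++ y ∷ post → y < u → u ∈ post
∈-++-∷⁻ʳ []        _         (here refl) y<u = ⊥-elim (<-irrefl refl y<u)
∈-++-∷⁻ʳ []        _         (there u∈)  _   = u∈
∈-++-∷⁻ʳ (_ ∷ pre) (p< ∷ _)  (here refl) y<u = ⊥-elim (<-asym y<u (All.lookup p< (∈-middle pre)))
∈-++-∷⁻ʳ (_ ∷ pre) (_ ∷ s)   (there u∈)  y<u = ∈-++-∷⁻ʳ pre s u∈ y<u

module _ {n d : ℕ} {τ : List ℕ → Sign} (cosig : IsCoSignotope n d τ) where

  series-move : ∀ {B y x z} → PlusSubset n d τ B → (y∈B : y ∈ B) → x ∉ B → z ∉ B → 1 ≤ x → z ≤ n → x < y → y < z →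
    Star (PlusEdge n d τ) B (B [ y∈B ↦ x ]) ⊎ Star (PlusEdge n d τ) B (B [ y∈B ↦ z ])
  series-move {B} {y} {x} {z} (dB , τB) y∈B x∉B z∉B 1≤x z≤max x<y y<z = move (∈-∃++ y∈X)
    where
    j = index y∈B
    Bj = B ─ y∈B
    X = complement n Bj
    entry : ℕ → List ℕ
    entry w = ins w Bj
    y-bounds = All.lookup (proj₁ (proj₂ dB)) y∈B
    y∈X : y ∈ X
    y∈X = ∈-complement⁺ n Bj (proj₁ y-bounds) (proj₂ y-bounds) (∉-─ (sorted⇒unique (dsubset-sorted dB)) y∈B)
    x∈X : x ∈ X
    x∈X = ∈-complement⁺ n Bj 1≤x (≤-trans (<⇒≤ x<y) (proj₂ y-bounds)) (x∉B ∘ ∈-removeAt⁻ B j)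
    z∈X : z ∈ X
    z∈X = ∈-complement⁺ n Bj (≤-trans (proj₁ y-bounds) (<⇒≤ y<z)) z≤max (z∉B ∘ ∈-removeAt⁻ B j)

    move : (∃₂ λ pre post → X ≡ pre ++ [ y ] ++ post) →
      Star (PlusEdge n d τ) B (entry x) ⊎ Star (PlusEdge n d τ) B (entry z)
    move (pre , post , X≡) = Sum.map towards-x towards-z (changes≤1-split (map τ P) (map τ Q) signs)
      where
      P = map entry pre
      Q = map entry post
      X-sorted : Sorted (pre ++ y ∷ post)
      X-sorted = subst Sorted X≡ (complement-sorted n Bj)
      series≡ : series n B j ≡ P ++ B ∷ Q
      series≡ = trans (cong (map entry) X≡)
        (trans (map-++ entry pre (y ∷ post)) (cong (λ R → P ++ R ∷ Q) (ins-─ (dsubset-sorted dB) y∈B)))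
      linked : Linked (SeriesStep n d) (P ++ B ∷ Q)
      linked = subst (Linked (SeriesStep n d)) series≡ (series-linked dB j)
      signs : changes (map τ P ++ plus ∷ map τ Q) ≤ 1
      signs = subst (λ ss → changes ss ≤ 1)
        (trans (cong (map τ) series≡) (trans (map-++ τ P (B ∷ Q)) (cong (λ s → map τ P ++ s ∷ map τ Q) τB)))
        (cosig B dB j)
      towards-x : All (_≡ plus) (map τ P) → Star (PlusEdge n d τ) B (entry x)
      towards-x P⁺ = linked⇒connected plus-edge-sym
        (plus-linked (Linked-++⁻ˡ (P ++ [ B ]) (subst (Linked (SeriesStep n d)) (sym (++-assoc P [ B ] Q)) linked))
                     (All.++⁺ (All.map⁻ P⁺) (τB ∷ [])))
        (∈-++⁺ʳ P (here refl))
        (∈-++⁺ˡ (∈-map⁺ entry (∈-++-∷⁻ˡ pre X-sorted (subst (x ∈_) X≡ x∈X) x<y)))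
      towards-z : All (_≡ plus) (map τ Q) → Star (PlusEdge n d τ) B (entry z)
      towards-z Q⁺ = linked⇒star-from-head plus-edge-sym
        (plus-linked (Linked-++⁻ʳ P linked) (τB ∷ All.map⁻ Q⁺))
        (there (∈-map⁺ entry (∈-++-∷⁻ʳ pre X-sorted (subst (z ∈_) X≡ z∈X) y<z)))

module _ {A : Set} {E : A → A → Set} (pos : A → ℕ → ℕ) (u : A) where

  AgreesOn : List ℕ → A → Set
  AgreesOn T w = ∀ {t} → t ∈ T → pos w t ≡ pos u t

  DiffersOn : List ℕ → A → Set
  DiffersOn T w = ∃ λ t → t ∈ T × pos w t ≢ pos u t

  Changers : List ℕ → Set
  Changers T = ∃ λ K → length K ≡ length T × Unique K × All (λ x → (∃ λ w → E w x) × DiffersOn T x) K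

  -- K lists, for each t ∈ T, the first vertex of the path at which position t leaves its value at u.
  distinct-changers : (∀ {w w'} → E w w' → DifferInAtMostOne (pos w) (pos w')) →
    ∀ {w v} → Star E w v → (T : List ℕ) → Unique T → AgreesOn T w → (∀ {t} → t ∈ T → pos v t ≢ pos u t) →
    Changers T
  distinct-changers _ ε [] _ _ _ = [] , refl , [] , []
  distinct-changers _ ε (_ ∷ _) _ agree differ = ⊥-elim (differ (here refl) (agree (here refl)))
  distinct-changers changes-one {w} (_◅_ {j = w'} e path) T uT agree differ
    with t₀ , same ← changes-one e
    with (t₀ ∈? T) ×-dec ¬? (pos w' t₀ ≟ pos u t₀)
  ... | no unchanged = distinct-changers changes-one path T uT agree′ differ
    where
    agree′ : AgreesOn T w'
    agree′ {t} t∈T with t ≟ t₀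
    ... | yes refl = decidable-stable (pos w' t ≟ pos u t) (λ ne → unchanged (t∈T , ne))
    ... | no t≢t₀  = trans (sym (same t≢t₀)) (agree t∈T)
  ... | yes (t₀∈T , changed) =
    let K , |K| , uK , K-ok =
          distinct-changers changes-one path (T ─ t₀∈T) (removeAt⁺ T _ uT) agree′ (differ ∘ ∈-removeAt⁻ T _)
    in w' ∷ K ,
       trans (cong suc |K|) (sym (length-removeAt′ T _)) ,
       All.tabulate (λ x∈K → w'≢ (All.lookup K-ok x∈K)) ∷ uK ,
       ((w , e) , t₀ , t₀∈T , changed) ∷ All.map (Product.map₂ widen) K-ok
    where
    agree′ : AgreesOn (T ─ t₀∈T) w'
    agree′ t∈ = trans (sym (same (λ { refl → ∉-─ uT t₀∈T t∈ }))) (agree (∈-removeAt⁻ T _ t∈))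
    w'≢ : ∀ {x} → (∃ λ w → E w x) × DiffersOn (T ─ t₀∈T) x → w' ≢ x
    w'≢ (_ , _ , t∈ , ne) refl = ne (agree′ t∈)
    widen : ∀ {x} → DiffersOn (T ─ t₀∈T) x → DiffersOn T x
    widen (t , t∈ , ne) = t , ∈-removeAt⁻ T _ t∈ , ne

sources-disconnected : ∀ {n d p τ i k} → d < n → p ≤ n ∸ d → HasPlusCount n d τ p → i ≤ d → k ≤ d → i ≢ k →
  PlusSubset n d τ (source n d i) → ¬ Star (PlusEdge n d τ) (source n d i) (source n d k)
sources-disconnected {n} {d} {p} {τ} {i} {k} d<n p≤m (L , |L| , _ , L↔) i≤d k≤d i≢k pSᵢ path =
  too-many (distinct-changers (position n) Sᵢ (λ { (adj , _) → adj-positions adj })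
              path (upTo m) (Unique.upTo⁺ m) (λ _ → refl) differ)
  where
  m = n ∸ d
  Sᵢ = source n d i
  differ : ∀ {t} → t ∈ upTo m → position n (source n d k) t ≢ position n Sᵢ t
  differ t∈ eq = i≢k (sym (suc-injective (+-cancelʳ-≡ _ _ _
    (trans (sym (position-source d<n k≤d (∈-upTo⁻ t∈))) (trans eq (position-source d<n i≤d (∈-upTo⁻ t∈)))))))
  too-many : ¬ Changers {E = PlusEdge n d τ} (position n) Sᵢ (upTo m)
  too-many (K , |K| , uK , K-ok) = <-irrefl refl (begin-strict
    m               ≡⟨ trans |K| (length-upTo m) ⟨
    length K        <⟨ n<1+n (length K) ⟩
    length (Sᵢ ∷ K) ≤⟨ unique-⊆⇒length≤ (All.tabulate Sᵢ≢ ∷ uK) ⊆L ⟩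
    length L        ≡⟨ |L| ⟩
    p               ≤⟨ p≤m ⟩
    m               ∎)
    where
    open ≤-Reasoning
    Sᵢ≢ : ∀ {x} → x ∈ K → Sᵢ ≢ x
    Sᵢ≢ x∈K refl with _ , _ , _ , ne ← All.lookup K-ok x∈K = ne refl
    ⊆L : Sᵢ ∷ K ⊆ L
    ⊆L (here refl) = Equivalence.from (L↔ _) pSᵢ
    ⊆L (there x∈K) with (_ , e) , _ ← All.lookup K-ok x∈K = Equivalence.from (L↔ _) (plus-edge-target e)

module _ {n d : ℕ} {τ : List ℕ → Sign} (cosig : IsCoSignotope n d τ) where

  ReachesSource : List ℕ → Set
  ReachesSource R = ∃ λ i → i ≤ d × Star (PlusEdge n d τ) R (source n d i)

  reaches-via : ∀ {R R'} → Star (PlusEdge n d τ) R R' → ReachesSource R' → ReachesSource R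
  reaches-via path (i , i≤d , path′) = i , i≤d , path ◅◅ path′

  reaches-source : ∀ fuel a e {R} → e ≤ a + fuel → a ≤ e → e ≤ n → PlusSubset n d τ R →
    [ 1 , a ]⊆ R → [ suc e , n ]⊆ R → ReachesSource R
  shrink-gap : ∀ fuel a e {R y} → e ≤ a + fuel → e ≤ n → PlusSubset n d τ R →
    [ 1 , a ]⊆ R → [ suc e , n ]⊆ R → y ∈ R → a < y → y ≤ e → ReachesSource R

  reaches-source fuel a e {R} e≤a+f a≤e e≤n pR lead trail with any? (λ x → (a <? x) ×-dec (x ≤? e)) R
  ... | yes gap with y , y∈R , a<y , y≤e ← find gap = shrink-gap fuel a e e≤a+f e≤n pR lead trail y∈R a<y y≤e
  ... | no no-gap
    with a≤d , R≡ ← gapless⇒source (proj₁ pR) lead trail a≤e e≤n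
                      (λ x∈R a<x → ≰⇒> (λ x≤e → no-gap (lose x∈R (a<x , x≤e)))) =
    a , a≤d , subst (Star (PlusEdge n d τ) R) R≡ ε

  shrink-gap zero    a e       e≤a+0 _ _ _ _ _ a<y y≤e =
    ⊥-elim (<-irrefl refl (<-≤-trans a<y (≤-trans y≤e (subst (e ≤_) (+-identityʳ a) e≤a+0))))
  shrink-gap (suc f) a zero    _ _ _ _ _ _ a<y y≤0 = ⊥-elim (n≮0 (<-≤-trans a<y y≤0))
  shrink-gap (suc f) a (suc e) {R} {y} e≤a+f e<n pR lead trail y∈R a<y y≤e with suc a ∈? R | suc e ∈? R
  ... | yes a+1∈R | _ =
    reaches-source f (suc a) (suc e) (subst (suc e ≤_) (+-suc a f) e≤a+f) (≤-trans a<y y≤e) e<n pR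
      (⊆-extendʳ lead a+1∈R) trail
  ... | no _ | yes e∈R =
    reaches-source f a e (≤-pred (subst (suc e ≤_) (+-suc a f) e≤a+f)) (≤-pred (≤-trans a<y y≤e)) (<⇒≤ e<n) pR
      lead (⊆-extendˡ e∈R trail)
  ... | no a+1∉R | no e∉R =
    [ towards-lead , towards-trail ]′ (series-move cosig pR y∈R a+1∉R e∉R (s≤s z≤n) e<n a+1<y y<e+1)
    where
    a+1<y : suc a < y
    a+1<y = ≤∧≢⇒< a<y (λ { refl → a+1∉R y∈R })
    y<e+1 : y < suc e
    y<e+1 = ≤∧≢⇒< y≤e (λ { refl → e∉R y∈R })
    towards-lead : Star (PlusEdge n d τ) R (R [ y∈R ↦ suc a ]) → ReachesSource R
    towards-lead path = reaches-via path (reaches-source f (suc a) (suc e) (subst (suc e ≤_) (+-suc a f) e≤a+f)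
      (≤-trans a<y y≤e) e<n (star-plus path pR)
      (⊆-extendʳ (⊆-↦ y∈R (suc a) lead (inj₂ a<y)) (∈-ins⁺ˡ (suc a) (R ─ y∈R)))
      (⊆-↦ y∈R (suc a) trail (inj₁ (s≤s y≤e))))
    towards-trail : Star (PlusEdge n d τ) R (R [ y∈R ↦ suc e ]) → ReachesSource R
    towards-trail path = reaches-via path (reaches-source f a e (≤-pred (subst (suc e ≤_) (+-suc a f) e≤a+f))
      (≤-pred (≤-trans a<y y≤e)) (<⇒≤ e<n) (star-plus path pR)
      (⊆-↦ y∈R (suc e) lead (inj₂ a<y))
      (⊆-extendˡ (∈-ins⁺ˡ (suc e) (R ─ y∈R)) (⊆-↦ y∈R (suc e) trail (inj₁ (s≤s y≤e)))))

  reaches-some-source : ∀ {R} → PlusSubset n d τ R → ReachesSource R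
  reaches-some-source pR = reaches-source n 0 n ≤-refl z≤n ≤-refl pR
    (λ 1≤x x≤0 → ⊥-elim (<-irrefl refl (≤-trans 1≤x x≤0)))
    (λ n<x x≤n → ⊥-elim (<-irrefl refl (<-≤-trans n<x x≤n)))

lemma8 : (n d p : ℕ) → d < n → p ≤ n ∸ d →
    (τ : List ℕ → Sign) → InSbar p n d τ →
    (R : List ℕ) → IsDSubset n d R → τ R ≡ plus →
    Σ ℕ (λ i → (i ≤ d × SameComp n d τ R (source n d i)) ×
      ((k : ℕ) → k ≤ d → SameComp n d τ R (source n d k) → k ≡ i))
lemma8 n d p d<n p≤n-d τ (cosig , count) R dR τR
  with i , i≤d , R→Sᵢ ← reaches-some-source cosig (dR , τR) =
  i , (i≤d , dR , τR , pSᵢ .proj₁ , pSᵢ .proj₂ , R→Sᵢ) , unique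
  where
  pSᵢ : PlusSubset n d τ (source n d i)
  pSᵢ = star-plus R→Sᵢ (dR , τR)
  unique : (k : ℕ) → k ≤ d → SameComp n d τ R (source n d k) → k ≡ i
  unique k k≤d (_ , _ , _ , _ , R→Sₖ) with k ≟ i
  ... | yes k≡i = k≡i
  ... | no k≢i  = ⊥-elim (sources-disconnected d<n p≤n-d count i≤d k≤d (k≢i ∘ sym) pSᵢ
                            (reverse plus-edge-sym R→Sᵢ ◅◅ R→Sₖ))
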